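{- Let $G=(V,E)$ be a temporal graph, $s\in V$, $t_s$ a real number, and let $T$ be the DFS-v2 tree of $G$ rooted at $s$ with starting time $t_s$. For a vertex $v$ let $O(v)$ be the set of occurrences of $v$ in $T$. Let $[t_x,t_y]$ be a time interval with $t_x\ge t_s$. For each vertex $v\neq s$ occurring in $T$, let $v_{\min}\in O(v)$ be an occurrence with $t_{start}(v_{\min})\ge t_x$, $t_{end}(v_{\min})\le t_y$ and $t_{end}(v_{\min})-t_{start}(v_{\min})=\min\{t_{end}(v_o)-t_{start}(v_o): v_o\in O(v),\ t_{start}(v_o)\ge t_x,\ t_{end}(v_o)\le t_y\}$. Then the path in $T$ from the root to $v_{\min}$ is a fastest path from $s$ to $v$ within $[t_x,t_y]$. If no such $v_{\min}$ exists, then no fastest path from $s$ to $v$ within $[t_x,t_y]$ exists in $G$.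
   Context: A temporal graph is $G=(V,E)$ with $V$ a finite vertex set and $E$ a finite set of temporal edges $(u,v,t)$, $u\neq v$, $t$ real; distinct temporal edges from $u$ to $v$ have distinct times. A time-respecting path from $s$ to $v$ is a sequence of temporal edges $(w_1,w_2,t_1),\dots,(w_k,w_{k+1},t_k)\in E$, $k\ge1$, with $w_1=s$, $w_{k+1}=v$, $t_1\le\dots\le t_k$; its start time is $t_1$ and end time $t_k$. A fastest path from $s$ to $v$ within $[t_x,t_y]$ is a time-respecting path from $s$ to $v$ with start time $\ge t_x$ and end time $\le t_y$ minimizing (end time $-$ start time) among all such paths. DFS-v2 from $s$ with starting time $t_s$: keep $\sigma(x)$ for every vertex, initially $\infty$; build a rooted tree $T$ of occurrences of vertices. Visit $s$: set $\sigma(s)=t_s$, create the root (an occurrence of $s$), make it current. Repeat: (a) let $u$ be the current occurrence's vertex and $E_u$ the set of not-yet-traversed edges $(u,v,t)\in E$ leaving $u$ with $\sigma(u)\le t$; if $E_u\neq\emptyset$, traverse an edge of $E_u$ of maximum time and go to (b); otherwise terminate if current is the root, else backtrack to the parent occurrence and repeat (a). (b) After traversing $(u,v,t)$: if $\sigma(v)>t$, set $\sigma(v)=t$, create a new occurrence of $v$ as a child of the current occurrence (the edge is a tree edge), make it current and go to (a); else repeat (a). Active interval: for a non-root occurrence $v_o$, the tree edges on the path from the root to $v_o$ form a sequence $(w_1,w_2,t_1),\dots,(w_k,w_{k+1},t_k)$; set $t_{start}(v_o)=t_1$ and $t_{end}(v_o)=t_k$.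
   Formalization: The edge times, the starting time $t_s$ and the interval endpoints $t_x$ and $t_y$ are rational rather than real. -}

module Defs where

open import Data.Nat using (ℕ)
open import Data.Fin using (Fin; _≟_)
open import Data.Rational using (ℚ; 0ℚ; _≤_; _<_; _-_)
open import Data.List using (List; []; _∷_; _∷ʳ_; reverse)
open import Data.List.Membership.Propositional using (_∈_; _∉_)
open import Data.Maybe using (Maybe; just; nothing)
open import Data.Bool using (if_then_else_)
open import Data.Product using (Σ; _×_; ∃)
open import Data.Empty using (⊥)
open import Data.Unit using (⊤)
open import Relation.Nullary using (¬_)
open import Relation.Nullary.Decidable using (⌊_⌋)
open import Relation.Binary.PropositionalEquality using (_≡_)
open import Relation.Binary.Construct.Closure.ReflexiveTransitive using (Star)

record Edge (n : ℕ) : Set where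
  constructor edge
  field
    src  : Fin n
    tgt  : Fin n
    time : ℚ
open Edge public

-- Extended times ℚ ∪ {∞}: nothing = ∞.
Time∞ : Set
Time∞ = Maybe ℚ

_<∞_ : ℚ → Time∞ → Set
t <∞ nothing = ⊤
t <∞ just x  = t < x

_∞≤_ : Time∞ → ℚ → Set
nothing ∞≤ t = ⊥
just x  ∞≤ t = x ≤ t

module _ {n : ℕ} where

  -- start / end time of a (nonempty) list of edges; the value on [] is never used
  startT : List (Edge n) → ℚ
  startT []      = 0ℚ
  startT (e ∷ _) = time e

  endT : List (Edge n) → ℚ
  endT []             = 0ℚ
  endT (e ∷ [])       = time e
  endT (_ ∷ e ∷ es)   = endT (e ∷ es)

  endV : List (Edge n) → Maybe (Fin n)
  endV []           = nothing
  endV (e ∷ [])     = just (tgt e)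
  endV (_ ∷ e ∷ es) = endV (e ∷ es)

  duration : List (Edge n) → ℚ
  duration p = endT p - startT p

  Within : ℚ → ℚ → List (Edge n) → Set
  Within tx ty p = (tx ≤ startT p) × (endT p ≤ ty)

module Temporal {n : ℕ} (E : List (Edge n)) where

  IsTRPath : Fin n → Fin n → List (Edge n) → Set
  IsTRPath s v []            = ⊥
  IsTRPath s v (e ∷ [])      = (e ∈ E) × (src e ≡ s) × (tgt e ≡ v)
  IsTRPath s v (e ∷ f ∷ es)  = (e ∈ E) × (src e ≡ s) × (time e ≤ time f) × IsTRPath (tgt e) v (f ∷ es)

  IsFastest : Fin n → Fin n → ℚ → ℚ → List (Edge n) → Set
  IsFastest s v tx ty p =
    IsTRPath s v p × Within tx ty p ×
    (∀ q → IsTRPath s v q → Within tx ty q → duration p ≤ duration q)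

  -- DFS-v2 from s, as a (nondeterministic) transition system.
  -- A state stores σ, the set of traversed edges, the current occurrence
  -- (as the reversed list of tree edges from the root to it), and the list
  -- of all non-root occurrences created so far, each given by its list of
  -- tree edges from the root (in order).  The root occurrence is [].
  module DFSv2 (s : Fin n) where

    record State : Set where
      constructor state
      field
        σ     : Fin n → Time∞
        trav  : List (Edge n)
        stk   : List (Edge n)
        occs  : List (List (Edge n))
    open State public

    curV : List (Edge n) → Fin n
    curV []      = s
    curV (e ∷ _) = tgt e

    update : (Fin n → Time∞) → Fin n → Time∞ → Fin n → Time∞
    update σ' v val x = if ⌊ x ≟ v ⌋ then val else σ' x

    Avail : (Fin n → Time∞) → List (Edge n) → List (Edge n) → Edge n → Set
    Avail σ' tr st e = (e ∈ E) × (e ∉ tr) × (src e ≡ curV st) × (σ' (src e) ∞≤ time e)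

    NoAvail : (Fin n → Time∞) → List (Edge n) → List (Edge n) → Set
    NoAvail σ' tr st = ∀ e → ¬ Avail σ' tr st e

    MaxAvail : (Fin n → Time∞) → List (Edge n) → List (Edge n) → Edge n → Set
    MaxAvail σ' tr st e = Avail σ' tr st e × (∀ f → Avail σ' tr st f → time f ≤ time e)

    data Step : State → State → Set where
      tree-edge : ∀ {σ' tr st os e} → MaxAvail σ' tr st e → time e <∞ σ' (tgt e) →
        Step (state σ' tr st os)
             (state (update σ' (tgt e) (just (time e))) (e ∷ tr) (e ∷ st) (os ∷ʳ reverse (e ∷ st)))
      nontree-edge : ∀ {σ' tr st os e} → MaxAvail σ' tr st e → ¬ (time e <∞ σ' (tgt e)) →
        Step (state σ' tr st os) (state σ' (e ∷ tr) st os)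
      backtrack : ∀ {σ' tr e st os} → NoAvail σ' tr (e ∷ st) →
        Step (state σ' tr (e ∷ st) os) (state σ' tr st os)

    initial : ℚ → State
    initial ts = state (λ x → if ⌊ x ≟ s ⌋ then just ts else nothing) [] [] []

    Terminal : State → Set
    Terminal st' = (stk st' ≡ []) × NoAvail (σ st') (trav st') (stk st')

    -- os is the list of non-root occurrences (root paths) of a DFS-v2 tree T
    -- from s with starting time ts (for some admissible run of the algorithm)
    IsDFSv2Tree : ℚ → List (List (Edge n)) → Set
    IsDFSv2Tree ts os = Σ State λ fin → Star Step (initial ts) fin × Terminal fin × (occs fin ≡ os)

    IsOcc : List (List (Edge n)) → Fin n → List (Edge n) → Set
    IsOcc os v p = (p ∈ os) × (endV p ≡ just v)

    IsVMin : List (List (Edge n)) → Fin n → ℚ → ℚ → List (Edge n) → Set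
    IsVMin os v tx ty p =
      IsOcc os v p × Within tx ty p ×
      (∀ q → IsOcc os v q → Within tx ty q → duration p ≤ duration q)

{-# OPTIONS --safe #-}
module Submission where

-- Call an occurrence p of x closed if every edge (x, y, t) with t ≥ t_end(p) leads to s or to an
-- occurrence of y active within [t_start(p), t].  An occurrence is closed once the search backtracks
-- from it: such an edge has been traversed, so σ(y) ≤ t, and σ(y) is the end time of an occurrence of
-- y, which started no earlier than p because root edges are explored in decreasing order of time.
-- At termination every occurrence is closed and every root edge at time ≥ ts has been traversed, so
-- walking along a time-respecting path q from s yields, vertex by vertex, occurrences active within
-- [t_start(q), t_end(q)].  Hence every path within [tx, ty] to v is at least as slow as some
-- occurrence of v within [tx, ty], and occurrences are themselves time-respecting paths from s.

open import Data.Nat using (ℕ)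
open import Data.Fin as Fin using (Fin)
open import Data.Rational as ℚ using (ℚ; _≤_; _<_)
import Data.Rational.Properties as ℚₚ
open import Data.List using (List; []; _∷_; _∷ʳ_; reverse; filter)
open import Data.List.Properties using (unfold-reverse)
open import Data.List.Membership.Propositional using (_∈_; _∉_)
open import Data.List.Membership.Propositional.Properties using (∈-++⁺ˡ; ∈-++⁺ʳ; ∈-filter⁺; ∈-filter⁻)
open import Data.List.Relation.Unary.Any using (here; there; any?)
open import Data.List.Relation.Unary.All as All using (All; []; _∷_)
open import Data.List.Relation.Unary.All.Properties using (∷ʳ⁺)
open import Data.List.Relation.Unary.Unique.Propositional using (Unique)
open import Relation.Binary.Bundles using (DecTotalOrder)
open import Data.List.Extrema (DecTotalOrder.totalOrder ℚₚ.≤-decTotalOrder)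
  using (argmin; argmin-all; f[argmin]≤f[xs])
open import Data.Maybe using (just; nothing)
open import Data.Maybe.Properties using (just-injective)
import Data.Maybe.Properties as Maybe
open import Data.Product using (_×_; _,_; proj₁; proj₂; ∃; uncurry)
open import Data.Product.Properties using (≡-dec)
open import Data.Sum as Sum using (_⊎_; inj₁; inj₂)
open import Data.Empty using (⊥-elim)
open import Data.Unit using (⊤; tt)
open import Function using (_∘_)
open import Relation.Nullary using (¬_; yes; no; contradiction)
open import Relation.Nullary.Decidable using (_×-dec_; map′)
open import Relation.Unary using (Pred; Decidable)
open import Relation.Binary.Definitions using (DecidableEquality)
open import Relation.Binary.PropositionalEquality using (_≡_; _≢_; refl; sym; trans; subst; cong)
open import Relation.Binary.Construct.Closure.ReflexiveTransitive using (Star; ε; _◅_)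

open import Defs

∃-argmin : ∀ {a p} {A : Set a} {P : Pred A p} → Decidable P → (f : A → ℚ) →
           ∀ {x xs} → x ∈ xs → P x →
           ∃ λ m → m ∈ xs × P m × ∀ {y} → y ∈ xs → P y → f m ≤ f y
∃-argmin {A = A} {P} P? f {x} {xs} x∈xs px = m , proj₁ m-ok , proj₂ m-ok , minimal
  where
  candidates : List A
  candidates = filter P? xs
  m : A
  m = argmin f x candidates
  m-ok : m ∈ xs × P m
  m-ok = argmin-all f (x∈xs , px) (All.tabulate (∈-filter⁻ P?))
  minimal : ∀ {y} → y ∈ xs → P y → f m ≤ f y
  minimal y∈xs py = All.lookup (f[argmin]≤f[xs] x candidates) (∈-filter⁺ P? y∈xs py)

<∞-∞≤-trans : ∀ {t u m} → t <∞ m → m ∞≤ u → t < u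
<∞-∞≤-trans {m = just x} t<x x≤u = ℚₚ.<-≤-trans t<x x≤u

<∞⇒¬∞≤ : ∀ {t m} → t <∞ m → ¬ (m ∞≤ t)
<∞⇒¬∞≤ t<m m≤t = ℚₚ.<-irrefl refl (<∞-∞≤-trans t<m m≤t)

≮∞⇒∞≤ : ∀ {t} m → ¬ (t <∞ m) → m ∞≤ t
≮∞⇒∞≤ nothing  t≮∞ = t≮∞ tt
≮∞⇒∞≤ (just x) t≮x = ℚₚ.≮⇒≥ t≮x

∈-∷ʳ : ∀ {a} {A : Set a} (xs : List A) {x} → x ∈ xs ∷ʳ x
∈-∷ʳ xs = ∈-++⁺ʳ xs (here refl)

module _ {n : ℕ} where

  _≟ₑ_ : DecidableEquality (Edge n)
  e ≟ₑ f = map′ (cong λ (u , v , t) → edge u v t) (cong λ e → src e , tgt e , time e)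
                (≡-dec Fin._≟_ (≡-dec Fin._≟_ ℚ._≟_) _ _)

  endT-∷ʳ : ∀ (p : List (Edge n)) e → endT (p ∷ʳ e) ≡ time e
  endT-∷ʳ []          e = refl
  endT-∷ʳ (_ ∷ [])    e = refl
  endT-∷ʳ (_ ∷ f ∷ p) e = endT-∷ʳ (f ∷ p) e

  endV-∷ʳ : ∀ (p : List (Edge n)) e → endV (p ∷ʳ e) ≡ just (tgt e)
  endV-∷ʳ []          e = refl
  endV-∷ʳ (_ ∷ [])    e = refl
  endV-∷ʳ (_ ∷ f ∷ p) e = endV-∷ʳ (f ∷ p) e

  startT-∷ʳ-∷ʳ : ∀ (p : List (Edge n)) f e → startT (p ∷ʳ f ∷ʳ e) ≡ startT (p ∷ʳ f)
  startT-∷ʳ-∷ʳ []      f e = refl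
  startT-∷ʳ-∷ʳ (_ ∷ _) f e = refl

  endT-reverse : ∀ e (st : List (Edge n)) → endT (reverse (e ∷ st)) ≡ time e
  endT-reverse e st rewrite unfold-reverse e st = endT-∷ʳ (reverse st) e

  endV-reverse : ∀ e (st : List (Edge n)) → endV (reverse (e ∷ st)) ≡ just (tgt e)
  endV-reverse e st rewrite unfold-reverse e st = endV-∷ʳ (reverse st) e

  startT-reverse : ∀ e g (st : List (Edge n)) → startT (reverse (e ∷ g ∷ st)) ≡ startT (reverse (g ∷ st))
  startT-reverse e g st rewrite unfold-reverse e (g ∷ st) | unfold-reverse g st =
    startT-∷ʳ-∷ʳ (reverse st) g e

  Within? : ∀ a b → Decidable (Within {n} a b)
  Within? a b p = (a ℚₚ.≤? startT p) ×-dec (endT p ℚₚ.≤? b)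

module Paths {n : ℕ} (E : List (Edge n)) where
  open Temporal E

  IsTRPath⇒endV : ∀ {x v} p → IsTRPath x v p → endV p ≡ just v
  IsTRPath⇒endV (_ ∷ [])     (_ , _ , refl)    = refl
  IsTRPath⇒endV (_ ∷ f ∷ p) (_ , _ , _ , path) = IsTRPath⇒endV (f ∷ p) path

  IsTRPath-∷ʳ : ∀ {x v} p → IsTRPath x v p → ∀ {e} → e ∈ E → src e ≡ v → endT p ≤ time e →
                IsTRPath x (tgt e) (p ∷ʳ e)
  IsTRPath-∷ʳ (f ∷ [])     (f∈E , src≡ , refl) e∈E src≡v f≤e = f∈E , src≡ , f≤e , e∈E , src≡v , refl
  IsTRPath-∷ʳ (f ∷ g ∷ p) (f∈E , src≡ , f≤g , path) e∈E src≡v p≤e =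
    f∈E , src≡ , f≤g , IsTRPath-∷ʳ (g ∷ p) path e∈E src≡v p≤e

  -- Read D b x as "x is reached by time b".
  edge-closed⇒path-closed : (a : ℚ) (D : ℚ → Fin n → Set) →
    (∀ {b b′ x} → b ≤ b′ → D b x → D b′ x) →
    (∀ {e} → e ∈ E → a ≤ time e → D (time e) (src e) → D (time e) (tgt e)) →
    ∀ {x v} q → IsTRPath x v q → a ≤ startT q → D (startT q) x → D (endT q) v
  edge-closed⇒path-closed a D mono step (f ∷ []) (f∈E , refl , refl) a≤f d = step f∈E a≤f d
  edge-closed⇒path-closed a D mono step (f ∷ g ∷ q) (f∈E , refl , f≤g , path) a≤f d =
    edge-closed⇒path-closed a D mono step (g ∷ q) path (ℚₚ.≤-trans a≤f f≤g) (mono f≤g (step f∈E a≤f d))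

module DFSv2Invariant {n : ℕ} (E : List (Edge n)) (s : Fin n) (ts : ℚ) where
  open Temporal E
  open DFSv2 s
  open Paths E

  update-≡ : ∀ σ′ v val → update σ′ v val v ≡ val
  update-≡ σ′ v val with v Fin.≟ v
  ... | yes _   = refl
  ... | no  v≢v = contradiction refl v≢v

  update-≢ : ∀ σ′ {v x} val → x ≢ v → update σ′ v val x ≡ σ′ x
  update-≢ σ′ {v} {x} val x≢v with x Fin.≟ v
  ... | yes x≡v = contradiction x≡v x≢v
  ... | no  _   = refl

  update-elim : ∀ {ℓ} (P : Fin n → Time∞ → Set ℓ) {σ′ v val} x →
                (x ≡ v → P x val) → P x (σ′ x) → P x (update σ′ v val x)
  update-elim P {v = v} x on-v off-v with x Fin.≟ v
  ... | yes x≡v = on-v x≡v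
  ... | no  _   = off-v

  update-lowers : ∀ σ′ v {t} y {u} → t <∞ σ′ v → σ′ y ∞≤ u → update σ′ v (just t) y ∞≤ u
  update-lowers σ′ v {t} y {u} t<σv σy≤u =
    update-elim (λ _ m → m ∞≤ u) {σ′} y (λ { refl → ℚₚ.<⇒≤ (<∞-∞≤-trans t<σv σy≤u) }) σy≤u

  update-keeps : ∀ σ′ v {t} y {u} → t <∞ σ′ v → σ′ y ≡ just u → u ≤ t → update σ′ v (just t) y ≡ just u
  update-keeps σ′ v {t} y {u} t<σv σy≡u u≤t =
    update-elim (λ _ m → m ≡ just u) {σ′} y
                (λ { refl → ⊥-elim (<∞⇒¬∞≤ t<σv (subst (_∞≤ t) (sym σy≡u) u≤t)) }) σy≡u

  Pending : List (Edge n) → Edge n → Set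
  Pending tr f = f ∈ E × f ∉ tr × src f ≡ s × ts ≤ time f

  Pending-∷ : ∀ {e tr f} → Pending (e ∷ tr) f → Pending tr f
  Pending-∷ (f∈E , f∉e∷tr , src≡s , ts≤f) = f∈E , f∉e∷tr ∘ there , src≡s , ts≤f

  Pending⇒Avail : ∀ {σ′ tr f} → σ′ s ≡ just ts → Pending tr f → Avail σ′ tr [] f
  Pending⇒Avail {σ′} {f = f} σs≡ts (f∈E , f∉tr , src≡s , ts≤f) =
    f∈E , f∉tr , src≡s , subst (_∞≤ time f) (sym (trans (cong σ′ src≡s) σs≡ts)) ts≤f

  -- s counts as reached at any time and within any interval, through the root occurrence.
  ReachedBy : List (List (Edge n)) → ℚ → Fin n → Set
  ReachedBy os u x = x ≡ s ⊎ ∃ λ p → IsOcc os x p × endT p ≤ u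

  ReachedWithin : List (List (Edge n)) → ℚ → ℚ → Fin n → Set
  ReachedWithin os a b x = x ≡ s ⊎ ∃ λ p → IsOcc os x p × Within a b p

  ReachedBy-∷ʳ : ∀ {os u x} q → ReachedBy os u x → ReachedBy (os ∷ʳ q) u x
  ReachedBy-∷ʳ q (inj₁ x≡s)                   = inj₁ x≡s
  ReachedBy-∷ʳ q (inj₂ (p , (p∈os , p↦x) , p≤u)) = inj₂ (p , (∈-++⁺ˡ p∈os , p↦x) , p≤u)

  ReachedWithin-∷ʳ : ∀ {os a b x} q → ReachedWithin os a b x → ReachedWithin (os ∷ʳ q) a b x
  ReachedWithin-∷ʳ q (inj₁ x≡s)                      = inj₁ x≡s
  ReachedWithin-∷ʳ q (inj₂ (p , (p∈os , p↦x) , within)) = inj₂ (p , (∈-++⁺ˡ p∈os , p↦x) , within)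

  ReachedWithin-mono : ∀ {os a a′ b b′ x} → a′ ≤ a → b ≤ b′ →
                       ReachedWithin os a b x → ReachedWithin os a′ b′ x
  ReachedWithin-mono a′≤a b≤b′ (inj₁ x≡s) = inj₁ x≡s
  ReachedWithin-mono a′≤a b≤b′ (inj₂ (p , occ , a≤p , p≤b)) =
    inj₂ (p , occ , ℚₚ.≤-trans a′≤a a≤p , ℚₚ.≤-trans p≤b b≤b′)

  Closed : List (List (Edge n)) → List (Edge n) → Set
  Closed os p = ∀ {x e} → endV p ≡ just x → e ∈ E → src e ≡ x → endT p ≤ time e →
                ReachedWithin os (startT p) (time e) (tgt e)

  Closed-∷ʳ : ∀ {os p} q → Closed os p → Closed (os ∷ʳ q) p
  Closed-∷ʳ q closed p↦x e∈E src≡x p≤e = ReachedWithin-∷ʳ q (closed p↦x e∈E src≡x p≤e)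

  data OnStack (p : List (Edge n)) : List (Edge n) → Set where
    top   : ∀ {e st} → p ≡ reverse (e ∷ st) → OnStack p (e ∷ st)
    below : ∀ {e st} → OnStack p st → OnStack p (e ∷ st)

  data StackPath : List (Edge n) → Set where
    []   : StackPath []
    root : ∀ {e} → e ∈ E → src e ≡ s → StackPath (e ∷ [])
    push : ∀ {e f st} → e ∈ E → src e ≡ tgt f → time f ≤ time e →
           StackPath (f ∷ st) → StackPath (e ∷ f ∷ st)

  StackPath-tail : ∀ {e st} → StackPath (e ∷ st) → StackPath st
  StackPath-tail (root _ _)       = []
  StackPath-tail (push _ _ _ path) = path

  StackPath-≤ : ∀ {g st t} → StackPath (g ∷ st) → time g ≤ t → All (λ h → time h ≤ t) (g ∷ st)
  StackPath-≤ (root _ _)          g≤t = g≤t ∷ []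
  StackPath-≤ (push _ _ f≤g path) g≤t = g≤t ∷ StackPath-≤ path (ℚₚ.≤-trans f≤g g≤t)

  StackPath-push : ∀ {st e} → StackPath st → e ∈ E → src e ≡ curV st → All (λ g → time g ≤ time e) st →
                   StackPath (e ∷ st)
  StackPath-push {[]}    []   e∈E src≡s _          = root e∈E src≡s
  StackPath-push {_ ∷ _} path e∈E src≡ (g≤e ∷ _) = push e∈E src≡ g≤e path

  StackPath⇒IsTRPath : ∀ {e st} → StackPath (e ∷ st) → IsTRPath s (tgt e) (reverse (e ∷ st))
  StackPath⇒IsTRPath (root e∈E src≡s) = e∈E , src≡s , refl
  StackPath⇒IsTRPath {e} (push {f = f} {st} e∈E src≡ f≤e path) rewrite unfold-reverse e (f ∷ st) =
    IsTRPath-∷ʳ (reverse (f ∷ st)) (StackPath⇒IsTRPath path) e∈E src≡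
                (subst (_≤ time e) (sym (endT-reverse f st)) f≤e)

  Avail⇒stack-≤ : ∀ {σ′ tr st e} → StackPath st → All (λ g → σ′ (tgt g) ≡ just (time g)) st →
                  Avail σ′ tr st e → All (λ g → time g ≤ time e) st
  Avail⇒stack-≤ {st = []}    _    _        _                       = []
  Avail⇒stack-≤ {σ′} {st = _ ∷ _} {e} path (σg ∷ _) (_ , _ , src≡ , σ≤e) =
    StackPath-≤ path (subst (_∞≤ time e) (trans (cong σ′ src≡) σg) σ≤e)

  stack-root-only : ∀ {st e} → All (λ g → tgt g ≢ s) st → src e ≡ curV st → src e ≡ s → st ≡ []
  stack-root-only {[]}    _           _    _     = refl
  stack-root-only {_ ∷ _} (g≢s ∷ _) src≡ src≡s = contradiction (trans (sym src≡) src≡s) g≢s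

  StartAfter : ℚ → List (List (Edge n)) → Set
  StartAfter a = All (λ p → a ≤ startT p)

  Separates : List (Edge n) → List (List (Edge n)) → ℚ → Set
  Separates tr os b = (∀ {f} → Pending tr f → time f ≤ b) × StartAfter b os

  StackSeparates : List (Edge n) → List (List (Edge n)) → List (Edge n) → Set
  StackSeparates tr os []         = ⊤
  StackSeparates tr os st@(_ ∷ _) = Separates tr os (startT (reverse st))

  StackSeparates-∷ : ∀ {e tr os} st → StackSeparates tr os st → StackSeparates (e ∷ tr) os st
  StackSeparates-∷ []      _                  = tt
  StackSeparates-∷ (_ ∷ _) (pending≤ , after) = (λ f-pending → pending≤ (Pending-∷ f-pending)) , after

  StackSeparates-pop : ∀ {tr os e} st → StackSeparates tr os (e ∷ st) → StackSeparates tr os st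
  StackSeparates-pop []       _   = tt
  StackSeparates-pop {tr} {os} {e} (g ∷ st) sep = subst (Separates tr os) (startT-reverse e g st) sep

  record Inv (S : State) : Set where
    field
      σ-root            : σ S s ≡ just ts
      σ-≥-ts            : ∀ {x u} → σ S x ∞≤ u → ts ≤ u
      σ-reached         : ∀ {x u} → σ S x ∞≤ u → ReachedBy (occs S) u x
      stack-path        : StackPath (stk S)
      stack-σ           : All (λ e → σ S (tgt e) ≡ just (time e)) (stk S)
      stack-avoids-root : All (λ e → tgt e ≢ s) (stk S)
      pending-first     : ∀ {f} → Pending (trav S) f → StartAfter (time f) (occs S)
      stack-separates   : StackSeparates (trav S) (occs S) (stk S)
      traversed-σ       : ∀ {e} → e ∈ trav S → σ S (tgt e) ∞≤ time e
      traversed-root    : ∀ {e} → e ∈ trav S → src e ≡ s → ReachedWithin (occs S) (time e) (time e) (tgt e)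
      open-or-closed    : All (λ p → OnStack p (stk S) ⊎ Closed (occs S) p) (occs S)
      occurrence-path   : All (λ p → ∃ λ w → IsTRPath s w p) (occs S)
  open Inv

  reached-within : ∀ {S a x u} → Inv S → StartAfter a (occs S) → σ S x ∞≤ u → ReachedWithin (occs S) a u x
  reached-within I after σx≤u with σ-reached I σx≤u
  ... | inj₁ x≡s                        = inj₁ x≡s
  ... | inj₂ (p , occ@(p∈os , _) , p≤u) = inj₂ (p , occ , All.lookup after p∈os , p≤u)

  root-Avail⇒Pending : ∀ {σ′ tr st os e} → Inv (state σ′ tr st os) → Avail σ′ tr st e →
                       src e ≡ s → Pending tr e
  root-Avail⇒Pending I (e∈E , e∉tr , _ , σ≤e) src≡s = e∈E , e∉tr , src≡s , σ-≥-ts I σ≤e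

  initial-Inv : Inv (initial ts)
  initial-Inv = record
    { σ-root            = update-≡ σ∞ s (just ts)
    ; σ-≥-ts            = λ {x} → update-elim (λ _ m → ∀ {u} → m ∞≤ u → ts ≤ u) {σ∞} x
                                    (λ _ ts≤u → ts≤u) λ ()
    ; σ-reached         = λ {x} → update-elim (λ x m → ∀ {u} → m ∞≤ u → ReachedBy [] u x) {σ∞} x
                                    (λ x≡s _ → inj₁ x≡s) λ ()
    ; stack-path        = []
    ; stack-σ           = []
    ; stack-avoids-root = []
    ; pending-first     = λ _ → []
    ; stack-separates   = tt
    ; traversed-σ       = λ ()
    ; traversed-root    = λ ()
    ; open-or-closed    = []
    ; occurrence-path   = []
    }
    where
    σ∞ : Fin n → Time∞
    σ∞ _ = nothing

  push-Separates : ∀ {σ′ tr st os e} → Inv (state σ′ tr st os) → MaxAvail σ′ tr st e →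
                   Separates tr os (startT (reverse (e ∷ st)))
  push-Separates {st = []} I (avail@(_ , _ , src≡s , _) , max) =
    (λ f-pending → max _ (Pending⇒Avail (σ-root I) f-pending)) ,
    pending-first I (root-Avail⇒Pending I avail src≡s)
  push-Separates {tr = tr} {g ∷ st} {os} {e} I _ =
    subst (Separates tr os) (sym (startT-reverse e g st)) (stack-separates I)

  tree-edge-avoids-root : ∀ {σ′ tr st os e} → Inv (state σ′ tr st os) → Avail σ′ tr st e →
                          time e <∞ σ′ (tgt e) → tgt e ≢ s
  tree-edge-avoids-root {σ′} {e = e} I (_ , _ , _ , σ≤e) earlier tgt≡s =
    <∞⇒¬∞≤ earlier (subst (_∞≤ time e) (sym (trans (cong σ′ tgt≡s) (σ-root I))) (σ-≥-ts I σ≤e))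

  root-edge-reached : ∀ {os e st} → st ≡ [] →
                      ReachedWithin (os ∷ʳ reverse (e ∷ st)) (time e) (time e) (tgt e)
  root-edge-reached {os} {e} refl = inj₂ (e ∷ [] , (∈-∷ʳ os , refl) , ℚₚ.≤-refl , ℚₚ.≤-refl)

  push-reached : ∀ {e st u} os → time e ≤ u → ReachedBy (os ∷ʳ reverse (e ∷ st)) u (tgt e)
  push-reached {e} {st} os e≤u =
    inj₂ (reverse (e ∷ st) , (∈-∷ʳ os , endV-reverse e st) , subst (_≤ _) (sym (endT-reverse e st)) e≤u)

  tree-Inv : ∀ {σ′ tr st os e} → Inv (state σ′ tr st os) → MaxAvail σ′ tr st e → time e <∞ σ′ (tgt e) →
             Inv (state (update σ′ (tgt e) (just (time e))) (e ∷ tr) (e ∷ st) (os ∷ʳ reverse (e ∷ st)))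
  tree-Inv {σ′} {tr} {st} {os} {e} I mx@(avail@(e∈E , _ , e-from-top , σ≤e) , _) earlier = record
    { σ-root            = trans (update-≢ σ′ _ (tgt≢s ∘ sym)) (σ-root I)
    ; σ-≥-ts            = λ {x} → update-elim (λ _ m → ∀ {u} → m ∞≤ u → ts ≤ u) {σ′} x
                                    (λ _ → ℚₚ.≤-trans (σ-≥-ts I σ≤e)) (σ-≥-ts I)
    ; σ-reached         = λ {x} → update-elim (λ x m → ∀ {u} → m ∞≤ u → ReachedBy os′ u x) {σ′} x
                                    (λ { refl → push-reached {e} {st} os }) (ReachedBy-∷ʳ new ∘ σ-reached I)
    ; stack-path        = path′
    ; stack-σ           = update-≡ σ′ (tgt e) _ ∷
                          All.zipWith (λ {g} → uncurry (update-keeps σ′ (tgt e) (tgt g) earlier)) (stack-σ I , below-e)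
    ; stack-avoids-root = tgt≢s ∷ stack-avoids-root I
    ; pending-first     = λ f-pending → let f-pending′ = Pending-∷ f-pending in
                            ∷ʳ⁺ (pending-first I f-pending′) (proj₁ sep f-pending′)
    ; stack-separates   = (λ f-pending → proj₁ sep (Pending-∷ f-pending)) , ∷ʳ⁺ (proj₂ sep) ℚₚ.≤-refl
    ; traversed-σ       = traversed-σ′
    ; traversed-root    = traversed-root′
    ; open-or-closed    = ∷ʳ⁺ (All.map (λ {p} → Sum.map below (Closed-∷ʳ {p = p} new)) (open-or-closed I))
                              (inj₁ (top refl))
    ; occurrence-path   = ∷ʳ⁺ (occurrence-path I) (tgt e , StackPath⇒IsTRPath path′)
    }
    where
    new : List (Edge n)
    new = reverse (e ∷ st)
    os′ : List (List (Edge n))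
    os′ = os ∷ʳ new
    sep : Separates tr os (startT new)
    sep = push-Separates I mx
    tgt≢s : tgt e ≢ s
    tgt≢s = tree-edge-avoids-root I avail earlier
    below-e : All (λ g → time g ≤ time e) st
    below-e = Avail⇒stack-≤ (stack-path I) (stack-σ I) avail
    path′ : StackPath (e ∷ st)
    path′ = StackPath-push (stack-path I) e∈E e-from-top below-e
    traversed-σ′ : ∀ {f} → f ∈ e ∷ tr → update σ′ (tgt e) (just (time e)) (tgt f) ∞≤ time f
    traversed-σ′ (here refl)      = subst (_∞≤ time e) (sym (update-≡ σ′ (tgt e) _)) ℚₚ.≤-refl
    traversed-σ′ {f} (there f∈tr) = update-lowers σ′ (tgt e) (tgt f) earlier (traversed-σ I f∈tr)
    traversed-root′ : ∀ {f} → f ∈ e ∷ tr → src f ≡ s → ReachedWithin os′ (time f) (time f) (tgt f)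
    traversed-root′ (here refl)  src≡s =
      root-edge-reached {os} {e} (stack-root-only {e = e} (stack-avoids-root I) e-from-top src≡s)
    traversed-root′ (there f∈tr) src≡s = ReachedWithin-∷ʳ new (traversed-root I f∈tr src≡s)

  nontree-Inv : ∀ {σ′ tr st os e} → Inv (state σ′ tr st os) → Avail σ′ tr st e →
                ¬ (time e <∞ σ′ (tgt e)) → Inv (state σ′ (e ∷ tr) st os)
  nontree-Inv {σ′} {tr} {st} {os} {e} I avail not-earlier = record
    { σ-root            = σ-root I
    ; σ-≥-ts            = σ-≥-ts I
    ; σ-reached         = σ-reached I
    ; stack-path        = stack-path I
    ; stack-σ           = stack-σ I
    ; stack-avoids-root = stack-avoids-root I
    ; pending-first     = pending-first I ∘ Pending-∷
    ; stack-separates   = StackSeparates-∷ st (stack-separates I)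
    ; traversed-σ       = traversed-σ′
    ; traversed-root    = traversed-root′
    ; open-or-closed    = open-or-closed I
    ; occurrence-path   = occurrence-path I
    }
    where
    σ-tgt≤e : σ′ (tgt e) ∞≤ time e
    σ-tgt≤e = ≮∞⇒∞≤ (σ′ (tgt e)) not-earlier
    traversed-σ′ : ∀ {f} → f ∈ e ∷ tr → σ′ (tgt f) ∞≤ time f
    traversed-σ′ (here refl)  = σ-tgt≤e
    traversed-σ′ (there f∈tr) = traversed-σ I f∈tr
    traversed-root′ : ∀ {f} → f ∈ e ∷ tr → src f ≡ s → ReachedWithin os (time f) (time f) (tgt f)
    traversed-root′ (here refl)  src≡s =
      reached-within I (pending-first I (root-Avail⇒Pending I avail src≡s)) σ-tgt≤e
    traversed-root′ (there f∈tr) src≡s = traversed-root I f∈tr src≡s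

  backtrack-Closed : ∀ {σ′ tr e st os} → Inv (state σ′ tr (e ∷ st) os) → NoAvail σ′ tr (e ∷ st) →
                     Closed os (reverse (e ∷ st))
  backtrack-Closed {σ′} {tr} {e} {st} I stuck {_} {f} p↦x f∈E src≡x e≤f with any? (f ≟ₑ_) tr
  ... | yes f∈tr = reached-within I (proj₂ (stack-separates I)) (traversed-σ I f∈tr)
  ... | no  f∉tr = contradiction (f∈E , f∉tr , src≡tgt , σ-src≤f) (stuck f)
    where
    src≡tgt : src f ≡ tgt e
    src≡tgt = trans src≡x (just-injective (trans (sym p↦x) (endV-reverse e st)))
    σ-src≤f : σ′ (src f) ∞≤ time f
    σ-src≤f = subst (_∞≤ time f) (sym (trans (cong σ′ src≡tgt) (All.head (stack-σ I))))
                    (subst (_≤ time f) (endT-reverse e st) e≤f)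

  backtrack-Inv : ∀ {σ′ tr e st os} → Inv (state σ′ tr (e ∷ st) os) → NoAvail σ′ tr (e ∷ st) →
                  Inv (state σ′ tr st os)
  backtrack-Inv {e = e} {st} {os} I stuck = record
    { σ-root            = σ-root I
    ; σ-≥-ts            = σ-≥-ts I
    ; σ-reached         = σ-reached I
    ; stack-path        = StackPath-tail (stack-path I)
    ; stack-σ           = All.tail (stack-σ I)
    ; stack-avoids-root = All.tail (stack-avoids-root I)
    ; pending-first     = pending-first I
    ; stack-separates   = StackSeparates-pop st (stack-separates I)
    ; traversed-σ       = traversed-σ I
    ; traversed-root    = traversed-root I
    ; open-or-closed    = All.map pop (open-or-closed I)
    ; occurrence-path   = occurrence-path I
    }
    where
    pop : ∀ {p} → OnStack p (e ∷ st) ⊎ Closed os p → OnStack p st ⊎ Closed os p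
    pop (inj₁ (top refl))  = inj₂ (backtrack-Closed I stuck)
    pop (inj₁ (below on))  = inj₁ on
    pop (inj₂ closed)      = inj₂ closed

  Step-Inv : ∀ {S S′} → Step S S′ → Inv S → Inv S′
  Step-Inv (tree-edge mx earlier)          I = tree-Inv I mx earlier
  Step-Inv (nontree-edge mx not-earlier)   I = nontree-Inv I (proj₁ mx) not-earlier
  Step-Inv (backtrack stuck)               I = backtrack-Inv I stuck

  Star-Inv : ∀ {S S′} → Star Step S S′ → Inv S → Inv S′
  Star-Inv ε            I = I
  Star-Inv (step ◅ run) I = Star-Inv run (Step-Inv step I)

  module _ {σ′ tr os} (I : Inv (state σ′ tr [] os)) (stuck : NoAvail σ′ tr []) where

    terminal-edge-closed : ∀ {a e} → ts ≤ a → e ∈ E → a ≤ time e →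
                           ReachedWithin os a (time e) (src e) → ReachedWithin os a (time e) (tgt e)
    terminal-edge-closed {e = e} ts≤a e∈E a≤e (inj₁ src≡s) with any? (e ≟ₑ_) tr
    ... | yes e∈tr = ReachedWithin-mono a≤e ℚₚ.≤-refl (traversed-root I e∈tr src≡s)
    ... | no  e∉tr =
      contradiction (Pending⇒Avail (σ-root I) (e∈E , e∉tr , src≡s , ℚₚ.≤-trans ts≤a a≤e)) (stuck e)
    terminal-edge-closed ts≤a e∈E a≤e (inj₂ (p , (p∈os , p↦src) , a≤p , p≤e))
      with All.lookup (open-or-closed I) p∈os
    ... | inj₁ ()
    ... | inj₂ closed = ReachedWithin-mono a≤p ℚₚ.≤-refl (closed p↦src e∈E refl p≤e)

    terminal-reaches : ∀ {v q} → IsTRPath s v q → ts ≤ startT q → ReachedWithin os (startT q) (endT q) v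
    terminal-reaches {q = q} path ts≤q =
      edge-closed⇒path-closed (startT q) (ReachedWithin os (startT q)) (ReachedWithin-mono ℚₚ.≤-refl)
                              (terminal-edge-closed ts≤q) q path ℚₚ.≤-refl (inj₁ refl)

  IsDFSv2Tree-dominates : ∀ {os tx ty v q} → IsDFSv2Tree ts os → ts ≤ tx → v ≢ s →
                          IsTRPath s v q → Within tx ty q →
                          ∃ λ p → IsOcc os v p × Within tx ty p × duration p ≤ duration q
  IsDFSv2Tree-dominates (state _ _ _ _ , run , (refl , stuck) , refl) ts≤tx v≢s path (tx≤q , q≤ty)
    with terminal-reaches (Star-Inv run initial-Inv) stuck path (ℚₚ.≤-trans ts≤tx tx≤q)
  ... | inj₁ v≡s                   = contradiction v≡s v≢s
  ... | inj₂ (p , occ , q≤p , p≤q) =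
    p , occ , (ℚₚ.≤-trans tx≤q q≤p , ℚₚ.≤-trans p≤q q≤ty) , ℚₚ.+-mono-≤ p≤q (ℚₚ.neg-antimono-≤ q≤p)

  IsDFSv2Tree-paths : ∀ {os v p} → IsDFSv2Tree ts os → IsOcc os v p → IsTRPath s v p
  IsDFSv2Tree-paths {p = p} (_ , run , _ , refl) (p∈os , p↦v)
    with All.lookup (occurrence-path (Star-Inv run initial-Inv)) p∈os
  ... | w , path =
    subst (λ w → IsTRPath s w p) (just-injective (trans (sym (IsTRPath⇒endV p path)) p↦v)) path

theorem4 : ∀ {n} (E : List (Edge n)) → Unique E → (∀ e → e ∈ E → src e ≢ tgt e) →
           (s : Fin n) (ts : ℚ) (os : List (List (Edge n))) →
           Temporal.DFSv2.IsDFSv2Tree E s ts os →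
           (tx ty : ℚ) → ts ≤ tx →
           (v : Fin n) → v ≢ s → ∃ (Temporal.DFSv2.IsOcc E s os v) →
           ((vmin : List (Edge n)) → Temporal.DFSv2.IsVMin E s os v tx ty vmin →
             Temporal.IsFastest E s v tx ty vmin)
           × (¬ ∃ (Temporal.DFSv2.IsVMin E s os v tx ty) →
             ¬ ∃ (Temporal.IsFastest E s v tx ty))
theorem4 {n} E _ _ s ts os tree tx ty ts≤tx v v≢s _ = vmin-fastest , no-vmin⇒no-fastest
  where
  open Temporal E
  open DFSv2 s
  open DFSv2Invariant E s ts using (IsDFSv2Tree-dominates; IsDFSv2Tree-paths)

  vmin-fastest : (vmin : List (Edge n)) → IsVMin os v tx ty vmin → IsFastest s v tx ty vmin
  vmin-fastest vmin (occ , within , minimal) = IsDFSv2Tree-paths tree occ , within , faster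
    where
    faster : ∀ q → IsTRPath s v q → Within tx ty q → duration vmin ≤ duration q
    faster q path q-within with IsDFSv2Tree-dominates tree ts≤tx v≢s path q-within
    ... | p , p-occ , p-within , p≤q = ℚₚ.≤-trans (minimal p p-occ p-within) p≤q

  ends-within? : Decidable (λ p → endV p ≡ just v × Within tx ty p)
  ends-within? p = Maybe.≡-dec Fin._≟_ (endV p) (just v) ×-dec Within? tx ty p

  no-vmin⇒no-fastest : ¬ ∃ (IsVMin os v tx ty) → ¬ ∃ (IsFastest s v tx ty)
  no-vmin⇒no-fastest no-vmin (q , path , q-within , _)
    with IsDFSv2Tree-dominates tree ts≤tx v≢s path q-within
  ... | p , (p∈os , p↦v) , p-within , _
    with ∃-argmin ends-within? duration p∈os (p↦v , p-within)
  ... | m , m∈os , (m↦v , m-within) , m-min =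
    no-vmin (m , (m∈os , m↦v) , m-within , λ y (y∈os , y↦v) y-within → m-min y∈os (y↦v , y-within))
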